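{- For every even $k \ge 4$, the graph $M_{\rm III}(k)$ is not word-representable.
   Context: A graph $G=(V,E)$ is word-representable if there is a word $w$ over $V$ such that for all distinct $a,b\in V$, $ab\in E$ iff $a$ and $b$ alternate in $w$ (the subsequence of $w$ formed by the occurrences of $a$ and $b$ is $abab\cdots$ or $baba\cdots$). For even $k\ge4$, $M_{\rm III}(k)$ is the split graph with clique $C=\{c_1,\dots,c_{k+1}\}$, independent set $I=\{b,a_1,\dots,a_{k-1}\}$, and $N(b)=\{c_2,\dots,c_{k-1},c_{k+1}\}$, $N(a_i)=\{c_i,c_{i+1}\}$ for $1\le i\le k-1$. -}

module Defs where

open import Level using (Level)
open import Data.Nat using (ℕ; zero; suc; _≤_; _∸_)
open import Data.Fin using (Fin; toℕ)
import Data.Fin.Properties as FinP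
open import Data.List using (List; []; _∷_)
open import Data.List.Membership.Propositional using (_∈_)
open import Data.Product using (Σ; _×_; _,_)
open import Data.Sum using (_⊎_)
open import Data.Empty using (⊥)
open import Data.Unit using (⊤)
open import Function.Bundles using (_⇔_)
open import Relation.Nullary using (¬_; yes; no)
open import Relation.Binary.PropositionalEquality using (_≡_; _≢_; refl; cong)
open import Relation.Binary.Definitions using (DecidableEquality)

NoRepeat : {V : Set} → List V → Set
NoRepeat []                = ⊤
NoRepeat (x ∷ [])          = ⊤
NoRepeat (x ∷ y ∷ xs)      = (x ≢ y) × NoRepeat (y ∷ xs)

restrict : {V : Set} → DecidableEquality V → V → V → List V → List V
restrict _≟_ a b []       = []
restrict _≟_ a b (x ∷ w) with x ≟ a | x ≟ b
... | yes _ | _     = x ∷ restrict _≟_ a b w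
... | no _  | yes _ = x ∷ restrict _≟_ a b w
... | no _  | no _  = restrict _≟_ a b w

-- a and b alternate in w: the restriction of w to {a,b} is abab⋯ or baba⋯
-- (for distinct a, b this is exactly "no two consecutive letters equal").
Alternate : {V : Set} → DecidableEquality V → List V → V → V → Set
Alternate eq w a b = NoRepeat (restrict eq a b w)

WordRepresentable : (V : Set) → DecidableEquality V → (V → V → Set) → Set
WordRepresentable V eq Adj =
  Σ (List V) λ w →
    ((v : V) → v ∈ w) ×
    ((x y : V) → x ≢ y → (Adj x y ⇔ Alternate eq w x y))

-- The graph M_III(k).
-- Vertices: c j  represents  c_{toℕ j + 1}   (1 ≤ index ≤ k+1),
--           bv   represents  b,
--           a i  represents  a_{toℕ i + 1}   (1 ≤ index ≤ k-1).

data VtxIII (k : ℕ) : Set where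
  c  : Fin (suc k) → VtxIII k
  bv : VtxIII k
  a  : Fin (k ∸ 1) → VtxIII k

idx : {n : ℕ} → Fin n → ℕ
idx j = suc (toℕ j)

_≟V_ : {k : ℕ} → DecidableEquality (VtxIII k)
c i ≟V c j with i FinP.≟ j
... | yes refl = yes refl
... | no ne    = no λ { refl → ne refl }
c i ≟V bv  = no λ ()
c i ≟V a j = no λ ()
bv ≟V c j  = no λ ()
bv ≟V bv   = yes refl
bv ≟V a j  = no λ ()
a i ≟V c j = no λ ()
a i ≟V bv  = no λ ()
a i ≟V a j with i FinP.≟ j
... | yes refl = yes refl
... | no ne    = no λ { refl → ne refl }

bAdj : (k : ℕ) → Fin (suc k) → Set
bAdj k j = (2 ≤ idx j × idx j ≤ k ∸ 1) ⊎ idx j ≡ suc k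

aAdj : (k : ℕ) → Fin (k ∸ 1) → Fin (suc k) → Set
aAdj k i j = idx j ≡ idx i ⊎ idx j ≡ suc (idx i)

AdjIII : (k : ℕ) → VtxIII k → VtxIII k → Set
AdjIII k (c i) (c j) = i ≢ j
AdjIII k bv    (c j) = bAdj k j
AdjIII k (c j) bv    = bAdj k j
AdjIII k (a i) (c j) = aAdj k i j
AdjIII k (c j) (a i) = aAdj k i j
AdjIII k _     _     = ⊥

-- In a word representing the graph any two clique vertices alternate, so "the
-- alternation of c_i and c_j begins with c_i" is a strict total order on C.
-- Comparing prefix counts shows that the clique vertices alternating with a
-- fixed vertex form an arc of the cycle obtained by closing this order up.
-- As a_i alternates exactly with c_i and c_{i+1}, these two are neighbours on
-- the cycle, so c_1, …, c_k is a path running around it in one direction, with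
-- c_{k+1} off the path.  Hence c_1 and c_k separate c_2 from c_{k+1}; but b
-- alternates with c_2 and c_{k+1} and with neither c_1 nor c_k.
module Submission where

open import Defs
open import Data.Nat using (ℕ; zero; suc; _+_; _≤_; _<_; z≤n; s≤s; s≤s⁻¹)
open import Data.Nat.Divisibility using (_∣_)
open import Data.Nat.Properties
  using (≤-trans; ≤-refl; n≤1+n; n<1+n; <⇒≤; <⇒≢; 0≢1+n; 1+n≰n; suc-injective; m≤n+m; m≢1+n+m;
         m≤n⇒m<n∨m≡n; m⊓n≤n; m≤n⇒m⊓n≡m; m≤n⇒∃[o]m+o≡n)
open import Data.Fin using (Fin; toℕ; fromℕ<)
open import Data.Fin.Properties using (toℕ-injective; toℕ-fromℕ<)
open import Data.List using (List; []; _∷_; take)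
open import Data.List.Membership.Propositional using (_∈_)
open import Data.List.Relation.Unary.All using (All; []; _∷_)
open import Data.List.Relation.Unary.Any using (here; there)
import Data.Product
open import Data.Product using (_×_; _,_; proj₁; proj₂)
import Data.Sum
open import Data.Sum using (_⊎_; inj₁; inj₂; swap)
open import Data.Empty using (⊥; ⊥-elim)
open import Data.Unit using (⊤; tt)
open import Function using (_∘_; flip)
open import Function.Bundles using (_⇔_; mk⇔; Equivalence)
open import Function.Construct.Composition using (_⇔-∘_)
open import Function.Construct.Identity using (⇔-id)
open import Relation.Nullary using (¬_; yes; no; contradiction)
open import Relation.Binary.Definitions using (DecidableEquality)
open import Relation.Binary.PropositionalEquality using (_≡_; _≢_; refl; sym; trans; cong; subst; subst₂)

module Alternation {V : Set} (_≟_ : DecidableEquality V) where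

  count : V → List V → ℕ
  count x []      = 0
  count x (z ∷ w) with z ≟ x
  ... | yes _ = suc (count x w)
  ... | no  _ = count x w

  count-here : ∀ x p → count x (x ∷ p) ≡ suc (count x p)
  count-here x p with x ≟ x
  ... | yes _  = refl
  ... | no x≢x = contradiction refl x≢x

  count-there : ∀ {x z} p → z ≢ x → count x (z ∷ p) ≡ count x p
  count-there {x} {z} p z≢x with z ≟ x
  ... | yes z≡x = contradiction z≡x z≢x
  ... | no  _   = refl

  Ahead : V → V → List V → Set
  Ahead x y p = count y p ≤ count x p × count x p ≤ suc (count y p)

  -- Leads x y w: the occurrences of x and y in w alternate, beginning with x
  -- (alternate⇔alternating).  Stated through prefix counts, so that chains of
  -- Leads become chains of inequalities.
  Leads : V → V → List V → Set
  Leads x y w = ∀ n → Ahead x y (take n w)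

  Alternating : V → V → List V → Set
  Alternating x y w = Leads x y w ⊎ Leads y x w

  leads-∷ : ∀ {x y x′ y′ z} w → (∀ p → Ahead x y (z ∷ p) ⇔ Ahead x′ y′ p) →
            Leads x y (z ∷ w) ⇔ Leads x′ y′ w
  leads-∷ w ahead = mk⇔
    (λ l n → Equivalence.to (ahead (take n w)) (l (suc n)))
    (λ { l zero → z≤n , z≤n ; l (suc n) → Equivalence.from (ahead (take n w)) (l n) })

  ahead-∷-self : ∀ {x y} → x ≢ y → ∀ p → Ahead x y (x ∷ p) ⇔ Ahead y x p
  ahead-∷-self {x} {y} x≢y p rewrite count-here x p | count-there p x≢y =
    mk⇔ (λ (y≤1+x , 1+x≤1+y) → s≤s⁻¹ 1+x≤1+y , y≤1+x)
        (λ (x≤y , y≤1+x) → y≤1+x , s≤s x≤y)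

  ahead-∷-other : ∀ {x y z} → z ≢ x → z ≢ y → ∀ p → Ahead x y (z ∷ p) ⇔ Ahead x y p
  ahead-∷-other z≢x z≢y p rewrite count-there p z≢x | count-there p z≢y = ⇔-id _

  ¬leads-∷ʳ : ∀ {x y} w → x ≢ y → ¬ Leads x y (y ∷ w)
  ¬leads-∷ʳ {x} {y} w x≢y l
    with subst₂ _≤_ (count-here y []) (count-there [] (x≢y ∘ sym)) (proj₁ (l 1))
  ... | ()

  restrict-comm : ∀ x y w → restrict _≟_ x y w ≡ restrict _≟_ y x w
  restrict-comm x y [] = refl
  restrict-comm x y (z ∷ w) with z ≟ x | z ≟ y
  ... | yes _ | yes _ = cong (z ∷_) (restrict-comm x y w)
  ... | yes _ | no  _ = cong (z ∷_) (restrict-comm x y w)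
  ... | no  _ | yes _ = cong (z ∷_) (restrict-comm x y w)
  ... | no  _ | no  _ = restrict-comm x y w

  restrict-⊆ : ∀ x y w → All (λ z → z ≡ x ⊎ z ≡ y) (restrict _≟_ x y w)
  restrict-⊆ x y [] = []
  restrict-⊆ x y (z ∷ w) with z ≟ x | z ≟ y
  ... | yes z≡x | _       = inj₁ z≡x ∷ restrict-⊆ x y w
  ... | no  _   | yes z≡y = inj₂ z≡y ∷ restrict-⊆ x y w
  ... | no  _   | no  _   = restrict-⊆ x y w

  AlternatesFrom : V → V → List V → Set
  AlternatesFrom x y []      = ⊤
  AlternatesFrom x y (z ∷ r) = z ≡ x × AlternatesFrom y x r

  alternatesFrom⇒noRepeat : ∀ {x y} r → x ≢ y → AlternatesFrom x y r → NoRepeat r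
  alternatesFrom⇒noRepeat []           _   _                = tt
  alternatesFrom⇒noRepeat (_ ∷ [])     _   _                = tt
  alternatesFrom⇒noRepeat (_ ∷ _ ∷ r) x≢y (refl , refl , af) =
    x≢y , alternatesFrom⇒noRepeat (_ ∷ r) (x≢y ∘ sym) (refl , af)

  noRepeat⇒alternatesFrom : ∀ {x y} r → All (λ z → z ≡ x ⊎ z ≡ y) r → NoRepeat r →
                            AlternatesFrom x y r ⊎ AlternatesFrom y x r
  noRepeat⇒alternatesFrom []           _                 _          = inj₁ tt
  noRepeat⇒alternatesFrom (_ ∷ [])     (inj₁ z≡x ∷ _)    _          = inj₁ (z≡x , tt)
  noRepeat⇒alternatesFrom (_ ∷ [])     (inj₂ z≡y ∷ _)    _          = inj₂ (z≡y , tt)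
  noRepeat⇒alternatesFrom (z ∷ z′ ∷ r) (z∈xy ∷ z′r∈xy) (z≢z′ , nr)
    with noRepeat⇒alternatesFrom (z′ ∷ r) z′r∈xy nr | z∈xy
  ... | inj₁ (z′≡x , _) | inj₁ z≡x = contradiction (trans z≡x (sym z′≡x)) z≢z′
  ... | inj₂ af         | inj₁ z≡x = inj₁ (z≡x , af)
  ... | inj₁ af         | inj₂ z≡y = inj₂ (z≡y , af)
  ... | inj₂ (z′≡y , _) | inj₂ z≡y = contradiction (trans z≡y (sym z′≡y)) z≢z′

  leads⇔alternatesFrom : ∀ {x y} w → x ≢ y → Leads x y w ⇔ AlternatesFrom x y (restrict _≟_ x y w)
  leads⇔alternatesFrom [] _ = mk⇔ (λ _ → tt) (λ { _ zero → z≤n , z≤n ; _ (suc _) → z≤n , z≤n })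
  leads⇔alternatesFrom {x} {y} (z ∷ w) x≢y with z ≟ x | z ≟ y
  ... | yes refl | yes z≡y = contradiction z≡y x≢y
  ... | yes refl | no  _ rewrite restrict-comm x y w =
    mk⇔ (refl ,_) proj₂ ⇔-∘ (leads⇔alternatesFrom w (x≢y ∘ sym) ⇔-∘ leads-∷ w (ahead-∷-self x≢y))
  ... | no z≢x   | yes refl = mk⇔ (λ l → contradiction l (¬leads-∷ʳ w x≢y)) (λ (z≡x , _) → contradiction z≡x z≢x)
  ... | no z≢x   | no z≢y =
    leads⇔alternatesFrom w x≢y ⇔-∘ leads-∷ w (ahead-∷-other z≢x z≢y)

  alternate⇔alternating : ∀ {x y} w → x ≢ y → Alternate _≟_ w x y ⇔ Alternating x y w
  alternate⇔alternating {x} {y} w x≢y = mk⇔ to from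
    where
      from-xy : Leads x y w ⇔ AlternatesFrom x y (restrict _≟_ x y w)
      from-xy = leads⇔alternatesFrom w x≢y
      from-yx : Leads y x w ⇔ AlternatesFrom y x (restrict _≟_ y x w)
      from-yx = leads⇔alternatesFrom w (x≢y ∘ sym)
      to : NoRepeat (restrict _≟_ x y w) → Alternating x y w
      to nr with noRepeat⇒alternatesFrom _ (restrict-⊆ x y w) nr
      ... | inj₁ af = inj₁ (Equivalence.from from-xy af)
      ... | inj₂ af = inj₂ (Equivalence.from from-yx (subst (AlternatesFrom y x) (restrict-comm x y w) af))
      from : Alternating x y w → NoRepeat (restrict _≟_ x y w)
      from (inj₁ l) = alternatesFrom⇒noRepeat _ x≢y (Equivalence.to from-xy l)
      from (inj₂ l) = subst NoRepeat (restrict-comm y x w)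
                        (alternatesFrom⇒noRepeat _ (x≢y ∘ sym) (Equivalence.to from-yx l))

  Dominates : V → V → List V → Set
  Dominates x y w = ∀ n → count y (take n w) ≤ count x (take n w)

  leads⇒dominates : ∀ {x y w} → Leads x y w → Dominates x y w
  leads⇒dominates l = proj₁ ∘ l

  dominates-trans : ∀ {x y z w} → Dominates x y w → Dominates y z w → Dominates x z w
  dominates-trans xy yz n = ≤-trans (yz n) (xy n)

  dominates-∷ : ∀ {x y z} w → z ≢ x → z ≢ y → Dominates x y (z ∷ w) → Dominates x y w
  dominates-∷ w z≢x z≢y d n = subst₂ _≤_ (count-there (take n w) z≢y) (count-there (take n w) z≢x) (d (suc n))

  dominates-asym : ∀ {x y} w → x ∈ w → x ≢ y → Dominates x y w → ¬ Dominates y x w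
  dominates-asym {x} {y} (z ∷ w) x∈zw x≢y dxy dyx with z ≟ x | z ≟ y
  ... | yes refl | _
    with subst₂ _≤_ (count-here x []) (count-there [] x≢y) (dyx 1)
  ...   | ()
  dominates-asym {x} {y} (z ∷ w) x∈zw x≢y dxy dyx | no _ | yes refl
    with subst₂ _≤_ (count-here y []) (count-there [] (x≢y ∘ sym)) (dxy 1)
  ...   | ()
  dominates-asym (z ∷ w) (here x≡z)  x≢y dxy dyx | no z≢x | no _ = z≢x (sym x≡z)
  dominates-asym (z ∷ w) (there x∈w) x≢y dxy dyx | no z≢x | no z≢y =
    dominates-asym w x∈w x≢y (dominates-∷ w z≢x z≢y dxy) (dominates-∷ w z≢y z≢x dyx)

  alternating-bound : ∀ {x y w} → Alternating x y w → ∀ n → count x (take n w) ≤ suc (count y (take n w))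
  alternating-bound (inj₁ xy) n = proj₂ (xy n)
  alternating-bound (inj₂ yx) n = ≤-trans (proj₁ (yx n)) (n≤1+n _)

  -- On every prefix  #v₃ ≤ #v₂ ≤ #v₁ ≤ #v₀ ≤ 1 + #v₃.
  leads-skip : ∀ {v₀ v₁ v₂ v₃ w} → Leads v₀ v₁ w → Leads v₁ v₂ w → Leads v₂ v₃ w →
               Alternating v₀ v₃ w → Leads v₀ v₂ w × Leads v₁ v₃ w
  leads-skip l₀₁ l₁₂ l₂₃ a₀₃ =
    (λ n → ≤-trans (proj₁ (l₁₂ n)) (proj₁ (l₀₁ n)) , ≤-trans (alternating-bound a₀₃ n) (s≤s (proj₁ (l₂₃ n)))) ,
    (λ n → ≤-trans (proj₁ (l₂₃ n)) (proj₁ (l₁₂ n)) , ≤-trans (proj₁ (l₀₁ n)) (alternating-bound a₀₃ n))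

module CyclicOrder {X : Set} (_⊏_ : X → X → Set)
  (⊏-trans : ∀ {x y z} → x ⊏ y → y ⊏ z → x ⊏ z)
  (⊏-connex : ∀ {x y} → x ≢ y → x ⊏ y ⊎ y ⊏ x) where

  _⋖_ : X → X → Set
  x ⋖ y = x ⊏ y × ∀ z → x ⊏ z → ¬ z ⊏ y

  IsMax : X → Set
  IsMax x = ∀ z → ¬ x ⊏ z

  IsMin : X → Set
  IsMin y = ∀ z → ¬ z ⊏ y

  -- Successor in the cycle obtained by closing ⊏ up from its maximum to its minimum.
  _↝_ : X → X → Set
  x ↝ y = x ⋖ y ⊎ (IsMax x × IsMin y)

  ↝-injectiveˡ : ∀ {x y z} → x ↝ y → z ↝ y → x ≢ z → ⊥
  ↝-injectiveˡ (inj₁ (x⊏y , x⋖y)) (inj₁ (z⊏y , z⋖y)) x≢z with ⊏-connex x≢z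
  ... | inj₁ x⊏z = x⋖y _ x⊏z z⊏y
  ... | inj₂ z⊏x = z⋖y _ z⊏x x⊏y
  ↝-injectiveˡ (inj₁ (x⊏y , _)) (inj₂ (_ , min-y)) _ = min-y _ x⊏y
  ↝-injectiveˡ (inj₂ (_ , min-y)) (inj₁ (z⊏y , _)) _ = min-y _ z⊏y
  ↝-injectiveˡ (inj₂ (max-x , _)) (inj₂ (max-z , _)) x≢z with ⊏-connex x≢z
  ... | inj₁ x⊏z = max-x _ x⊏z
  ... | inj₂ z⊏x = max-z _ z⊏x

  ↝-injectiveʳ : ∀ {x y z} → x ↝ y → x ↝ z → y ≢ z → ⊥
  ↝-injectiveʳ (inj₁ (x⊏y , x⋖y)) (inj₁ (x⊏z , x⋖z)) y≢z with ⊏-connex y≢z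
  ... | inj₁ y⊏z = x⋖z _ x⊏y y⊏z
  ... | inj₂ z⊏y = x⋖y _ x⊏z z⊏y
  ↝-injectiveʳ (inj₁ (x⊏y , _)) (inj₂ (max-x , _)) _ = max-x _ x⊏y
  ↝-injectiveʳ (inj₂ (max-x , _)) (inj₁ (x⊏z , _)) _ = max-x _ x⊏z
  ↝-injectiveʳ (inj₂ (_ , min-y)) (inj₂ (_ , min-z)) y≢z with ⊏-connex y≢z
  ... | inj₁ y⊏z = min-z _ y⊏z
  ... | inj₂ z⊏y = min-y _ z⊏y

  ↝-below : ∀ {x y e} → x ↝ y → x ⊏ e → e ≢ y → x ⊏ y × y ⊏ e
  ↝-below (inj₁ (x⊏y , x⋖y)) x⊏e e≢y with ⊏-connex e≢y
  ... | inj₁ e⊏y = contradiction e⊏y (x⋖y _ x⊏e)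
  ... | inj₂ y⊏e = x⊏y , y⊏e
  ↝-below (inj₂ (max-x , _)) x⊏e _ = contradiction x⊏e (max-x _)

  ↝-above : ∀ {x y e} → x ↝ y → e ⊏ y → e ≢ x → e ⊏ x × x ⊏ y
  ↝-above (inj₁ (x⊏y , x⋖y)) e⊏y e≢x with ⊏-connex e≢x
  ... | inj₁ e⊏x = e⊏x , x⊏y
  ... | inj₂ x⊏e = contradiction e⊏y (x⋖y _ x⊏e)
  ↝-above (inj₂ (_ , min-y)) e⊏y _ = contradiction e⊏y (min-y _)

  Between : X → X → X → Set
  Between u v p = (u ⊏ p × p ⊏ v) ⊎ (v ⊏ p × p ⊏ u)

  Outside : X → X → X → Set
  Outside u v q = (q ⊏ u × q ⊏ v) ⊎ (u ⊏ q × v ⊏ q)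

  Separate : X → X → X → X → Set
  Separate u v p q = (Between u v p × Outside u v q) ⊎ (Between u v q × Outside u v p)

  module _ {f : ℕ → X} {e : X} {m : ℕ}
           (f-injective : ∀ {s t} → s ≤ m → t ≤ m → f s ≡ f t → s ≡ t)
           (e∉f : ∀ {t} → t ≤ m → f t ≢ e)
           (f↝ : ∀ t → t < m → f t ↝ f (suc t)) where

    path-below : ∀ {i j} → i < j → j ≤ m → f i ⊏ e → f i ⊏ f j × f j ⊏ e
    path-below {i} {suc j} (s≤s i≤j) j<m fi⊏e with m≤n⇒m<n∨m≡n i≤j
    ... | inj₂ refl = ↝-below (f↝ i j<m) fi⊏e (e∉f j<m ∘ sym)
    ... | inj₁ i<j  =
      let fi⊏fj , fj⊏e       = path-below i<j (<⇒≤ j<m) fi⊏e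
          fj⊏fj+1 , fj+1⊏e = ↝-below (f↝ j j<m) fj⊏e (e∉f j<m ∘ sym)
      in ⊏-trans fi⊏fj fj⊏fj+1 , fj+1⊏e

    path-above : ∀ {i j} → i < j → j ≤ m → e ⊏ f j → e ⊏ f i × f i ⊏ f j
    path-above {i} {suc j} (s≤s i≤j) j<m e⊏fj+1 with m≤n⇒m<n∨m≡n i≤j
    ... | inj₂ refl = ↝-above (f↝ i j<m) e⊏fj+1 (e∉f (<⇒≤ j<m) ∘ sym)
    ... | inj₁ i<j  =
      let e⊏fj , fj⊏fj+1 = ↝-above (f↝ j j<m) e⊏fj+1 (e∉f (<⇒≤ j<m) ∘ sym)
          e⊏fi , fi⊏fj   = path-above i<j (<⇒≤ j<m) e⊏fj
      in e⊏fi , ⊏-trans fi⊏fj fj⊏fj+1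

    ascending-path-separates : 1 < m → Separate (f 0) (f m) (f 1) e
    ascending-path-separates 1<m with ⊏-connex (e∉f z≤n)
    ... | inj₁ f₀⊏e =
      let f₀⊏f₁ , f₁⊏e = path-below (s≤s z≤n) (<⇒≤ 1<m) f₀⊏e
          f₁⊏fₘ , fₘ⊏e = path-below 1<m ≤-refl f₁⊏e
      in inj₁ (inj₁ (f₀⊏f₁ , f₁⊏fₘ) , inj₂ (f₀⊏e , fₘ⊏e))
    ... | inj₂ e⊏f₀ with ⊏-connex (e∉f ≤-refl ∘ sym)
    ...   | inj₁ e⊏fₘ =
      let e⊏f₁ , f₁⊏fₘ = path-above 1<m ≤-refl e⊏fₘ
          _ , f₀⊏f₁    = path-above (s≤s z≤n) (<⇒≤ 1<m) e⊏f₁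
      in inj₁ (inj₁ (f₀⊏f₁ , f₁⊏fₘ) , inj₁ (e⊏f₀ , e⊏fₘ))
    ...   | inj₂ fₘ⊏e = inj₂ (inj₂ (fₘ⊏e , e⊏f₀) , f₁-outside (f↝ 0 (<⇒≤ 1<m)))
      where
        f₁-outside : f 0 ↝ f 1 → Outside (f 0) (f m) (f 1)
        f₁-outside (inj₁ (f₀⊏f₁ , _)) = inj₂ (f₀⊏f₁ , ⊏-trans (⊏-trans fₘ⊏e e⊏f₀) f₀⊏f₁)
        f₁-outside (inj₂ (_ , min-f₁)) with ⊏-connex (λ f₀≡f₁ → 0≢1+n (f-injective z≤n (<⇒≤ 1<m) f₀≡f₁))
                                         | ⊏-connex (λ f₁≡fₘ → <⇒≢ 1<m (f-injective (<⇒≤ 1<m) ≤-refl f₁≡fₘ))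
        ... | inj₂ f₁⊏f₀ | inj₁ f₁⊏fₘ = inj₁ (f₁⊏f₀ , f₁⊏fₘ)
        ... | inj₁ f₀⊏f₁ | _          = contradiction f₀⊏f₁ (min-f₁ _)
        ... | _          | inj₂ fₘ⊏f₁ = contradiction fₘ⊏f₁ (min-f₁ _)

module CyclicPath {X : Set} (_⊏_ : X → X → Set)
  (⊏-trans : ∀ {x y z} → x ⊏ y → y ⊏ z → x ⊏ z)
  (⊏-connex : ∀ {x y} → x ≢ y → x ⊏ y ⊎ y ⊏ x) where

  open CyclicOrder _⊏_ ⊏-trans ⊏-connex

  private
    module Op = CyclicOrder (flip _⊏_) (λ y⊏x z⊏y → ⊏-trans z⊏y y⊏x) (swap ∘ ⊏-connex)

  ↝⇒op : ∀ {x y} → y ↝ x → x Op.↝ y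
  ↝⇒op (inj₁ (y⊏x , y⋖x))     = inj₁ (y⊏x , λ z z⊏x y⊏z → y⋖x z y⊏z z⊏x)
  ↝⇒op (inj₂ (max-y , min-x)) = inj₂ (min-x , max-y)

  op⇒between : ∀ {u v p} → Op.Between u v p → Between u v p
  op⇒between = swap ∘ Data.Sum.map Data.Product.swap Data.Product.swap

  op⇒outside : ∀ {u v p} → Op.Outside u v p → Outside u v p
  op⇒outside = swap

  op⇒separate : ∀ {u v p q} → Op.Separate u v p q → Separate u v p q
  op⇒separate = Data.Sum.map (Data.Product.map op⇒between op⇒outside) (Data.Product.map op⇒between op⇒outside)

  module _ {f : ℕ → X} {e : X} {m : ℕ}
           (f-injective : ∀ {s t} → s ≤ m → t ≤ m → f s ≡ f t → s ≡ t)
           (e∉f : ∀ {t} → t ≤ m → f t ≢ e)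
           (steps : ∀ t → t < m → f t ↝ f (suc t) ⊎ f (suc t) ↝ f t) where

    private
      f-skip : ∀ t → suc (suc t) ≤ m → f t ≢ f (suc (suc t))
      f-skip t t+2≤m = m≢1+n+m t ∘ f-injective (≤-trans (m≤n+m t 2) t+2≤m) t+2≤m

    -- By injectivity of ↝ a path that never doubles back keeps its initial direction.
    ascending : f 0 ↝ f 1 → ∀ t → t < m → f t ↝ f (suc t)
    ascending f₀↝f₁ zero    _     = f₀↝f₁
    ascending f₀↝f₁ (suc t) t+1<m with steps (suc t) t+1<m
    ... | inj₁ forward  = forward
    ... | inj₂ backward = ⊥-elim (↝-injectiveˡ (ascending f₀↝f₁ t (<⇒≤ t+1<m)) backward (f-skip t t+1<m))

    descending : f 1 ↝ f 0 → ∀ t → t < m → f (suc t) ↝ f t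
    descending f₁↝f₀ zero    _     = f₁↝f₀
    descending f₁↝f₀ (suc t) t+1<m with steps (suc t) t+1<m
    ... | inj₁ forward  = ⊥-elim (↝-injectiveʳ (descending f₁↝f₀ t (<⇒≤ t+1<m)) forward (f-skip t t+1<m))
    ... | inj₂ backward = backward

    -- A descending path is an ascending one for the opposite order.
    path-separates : 1 < m → Separate (f 0) (f m) (f 1) e
    path-separates 1<m with steps 0 (<⇒≤ 1<m)
    ... | inj₁ f₀↝f₁ = ascending-path-separates f-injective e∉f (ascending f₀↝f₁) 1<m
    ... | inj₂ f₁↝f₀ =
      op⇒separate (Op.ascending-path-separates f-injective e∉f (λ t t<m → ↝⇒op (descending f₁↝f₀ t t<m)) 1<m)

module Clique {V C : Set} (_≟_ : DecidableEquality V) (w : List V)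
  (c : C → V) (c-injective : ∀ {i j} → c i ≡ c j → i ≡ j) (c∈w : ∀ i → c i ∈ w)
  (clique : ∀ {i j} → i ≢ j → Alternation.Alternating _≟_ (c i) (c j) w) where

  open Alternation _≟_

  _⊏_ : C → C → Set
  i ⊏ j = i ≢ j × Leads (c i) (c j) w

  ⊏-connex : ∀ {i j} → i ≢ j → i ⊏ j ⊎ j ⊏ i
  ⊏-connex i≢j = Data.Sum.map (i≢j ,_) ((i≢j ∘ sym) ,_) (clique i≢j)

  ⊏-asym : ∀ {i j} → i ⊏ j → ¬ j ⊏ i
  ⊏-asym {i} (i≢j , ci≺cj) (_ , cj≺ci) =
    dominates-asym w (c∈w i) (i≢j ∘ c-injective) (leads⇒dominates ci≺cj) (leads⇒dominates cj≺ci)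

  ⊏-trans : ∀ {i j l} → i ⊏ j → j ⊏ l → i ⊏ l
  ⊏-trans {i} {j} {l} i⊏j j⊏l with ⊏-connex {i} {l} (λ { refl → ⊏-asym i⊏j j⊏l })
  ... | inj₁ i⊏l         = i⊏l
  ... | inj₂ (l≢i , cl≺ci) =
    ⊥-elim (dominates-asym w (c∈w i) (l≢i ∘ sym ∘ c-injective)
             (dominates-trans (leads⇒dominates (proj₂ i⊏j)) (leads⇒dominates (proj₂ j⊏l)))
             (leads⇒dominates cl≺ci))

  open CyclicOrder _⊏_ ⊏-trans ⊏-connex public
  open CyclicPath _⊏_ ⊏-trans ⊏-connex public using (path-separates)

  _∼_ : V → C → Set
  x ∼ i = Alternating x (c i) w

  alternating-adjacent-⊏ : ∀ {x i j} → x ∼ i → x ∼ j → i ⊏ j → (∀ {l} → l ≢ i → l ≢ j → ¬ x ∼ l) →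
                     i ↝ j ⊎ j ↝ i
  alternating-adjacent-⊏ {x} {i} {j} x∼i x∼j i⊏j ≁ with x∼i | x∼j
  ... | inj₁ x≺i | _ = inj₁ (inj₁ (i⊏j , λ l i⊏l l⊏j →
    ≁ (proj₁ i⊏l ∘ sym) (proj₁ l⊏j) (inj₁ (proj₁ (leads-skip x≺i (proj₂ i⊏l) (proj₂ l⊏j) x∼j)))))
  ... | inj₂ i≺x | inj₂ j≺x = inj₁ (inj₁ (i⊏j , λ l i⊏l l⊏j →
    ≁ (proj₁ i⊏l ∘ sym) (proj₁ l⊏j) (inj₂ (proj₂ (leads-skip (proj₂ i⊏l) (proj₂ l⊏j) j≺x (inj₁ i≺x))))))
  ... | inj₂ i≺x | inj₁ x≺j = inj₂ (inj₂ (max-j , min-i))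
    where
      min-i : IsMin i
      min-i l l⊏i = ≁ (proj₁ l⊏i) (proj₁ (⊏-trans l⊏i i⊏j))
                      (inj₂ (proj₁ (leads-skip (proj₂ l⊏i) i≺x x≺j (inj₁ (proj₂ (⊏-trans l⊏i i⊏j))))))
      max-j : IsMax j
      max-j l j⊏l = ≁ (proj₁ (⊏-trans i⊏j j⊏l) ∘ sym) (proj₁ j⊏l ∘ sym)
                      (inj₁ (proj₂ (leads-skip i≺x x≺j (proj₂ j⊏l) (inj₁ (proj₂ (⊏-trans i⊏j j⊏l))))))

  alternating-adjacent : ∀ {x i j} → x ∼ i → x ∼ j → i ≢ j → (∀ {l} → l ≢ i → l ≢ j → ¬ x ∼ l) →
                         i ↝ j ⊎ j ↝ i
  alternating-adjacent x∼i x∼j i≢j ≁ with ⊏-connex i≢j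
  ... | inj₁ i⊏j = alternating-adjacent-⊏ x∼i x∼j i⊏j ≁
  ... | inj₂ j⊏i = swap (alternating-adjacent-⊏ x∼j x∼i j⊏i (λ l≢j l≢i → ≁ l≢i l≢j))

  ¬alternating-1010 : ∀ {x i₁ i₂ i₃ i₄} → i₁ ⊏ i₂ → i₂ ⊏ i₃ → i₃ ⊏ i₄ →
                      x ∼ i₁ → ¬ x ∼ i₂ → x ∼ i₃ → ¬ x ∼ i₄ → ⊥
  ¬alternating-1010 i₁⊏i₂ i₂⊏i₃ i₃⊏i₄ (inj₁ x≺i₁) x≁i₂ x∼i₃ x≁i₄ =
    x≁i₂ (inj₁ (proj₁ (leads-skip x≺i₁ (proj₂ i₁⊏i₂) (proj₂ i₂⊏i₃) x∼i₃)))
  ¬alternating-1010 i₁⊏i₂ i₂⊏i₃ i₃⊏i₄ (inj₂ i₁≺x) x≁i₂ (inj₁ x≺i₃) x≁i₄ =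
    x≁i₄ (inj₁ (proj₂ (leads-skip i₁≺x x≺i₃ (proj₂ i₃⊏i₄) (inj₁ (proj₂ (⊏-trans (⊏-trans i₁⊏i₂ i₂⊏i₃) i₃⊏i₄))))))
  ¬alternating-1010 i₁⊏i₂ i₂⊏i₃ i₃⊏i₄ (inj₂ i₁≺x) x≁i₂ (inj₂ i₃≺x) x≁i₄ =
    x≁i₂ (inj₂ (proj₂ (leads-skip (proj₂ i₁⊏i₂) (proj₂ i₂⊏i₃) i₃≺x (inj₁ i₁≺x))))

  ¬alternating-0101 : ∀ {x i₁ i₂ i₃ i₄} → i₁ ⊏ i₂ → i₂ ⊏ i₃ → i₃ ⊏ i₄ →
                      ¬ x ∼ i₁ → x ∼ i₂ → ¬ x ∼ i₃ → x ∼ i₄ → ⊥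
  ¬alternating-0101 i₁⊏i₂ i₂⊏i₃ i₃⊏i₄ x≁i₁ (inj₁ x≺i₂) x≁i₃ x∼i₄ =
    x≁i₃ (inj₁ (proj₁ (leads-skip x≺i₂ (proj₂ i₂⊏i₃) (proj₂ i₃⊏i₄) x∼i₄)))
  ¬alternating-0101 i₁⊏i₂ i₂⊏i₃ i₃⊏i₄ x≁i₁ (inj₂ i₂≺x) x≁i₃ (inj₂ i₄≺x) =
    x≁i₃ (inj₂ (proj₂ (leads-skip (proj₂ i₂⊏i₃) (proj₂ i₃⊏i₄) i₄≺x (inj₁ i₂≺x))))
  ¬alternating-0101 i₁⊏i₂ i₂⊏i₃ i₃⊏i₄ x≁i₁ (inj₂ i₂≺x) x≁i₃ (inj₁ x≺i₄) =
    x≁i₁ (inj₂ (proj₁ (leads-skip (proj₂ i₁⊏i₂) i₂≺x x≺i₄ (inj₁ (proj₂ (⊏-trans (⊏-trans i₁⊏i₂ i₂⊏i₃) i₃⊏i₄))))))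

  ¬alternating-between-outside : ∀ {x u v p q} → Between u v p → Outside u v q →
                                 x ∼ p → x ∼ q → ¬ x ∼ u → ¬ x ∼ v → ⊥
  ¬alternating-between-outside (inj₁ (u⊏p , p⊏v)) (inj₁ (q⊏u , _)) x∼p x∼q x≁u x≁v =
    ¬alternating-1010 q⊏u u⊏p p⊏v x∼q x≁u x∼p x≁v
  ¬alternating-between-outside (inj₁ (u⊏p , p⊏v)) (inj₂ (_ , v⊏q)) x∼p x∼q x≁u x≁v =
    ¬alternating-0101 u⊏p p⊏v v⊏q x≁u x∼p x≁v x∼q
  ¬alternating-between-outside (inj₂ (v⊏p , p⊏u)) (inj₁ (_ , q⊏v)) x∼p x∼q x≁u x≁v =
    ¬alternating-1010 q⊏v v⊏p p⊏u x∼q x≁v x∼p x≁u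
  ¬alternating-between-outside (inj₂ (v⊏p , p⊏u)) (inj₂ (u⊏q , _)) x∼p x∼q x≁u x≁v =
    ¬alternating-0101 v⊏p p⊏u u⊏q x≁v x∼p x≁u x∼q

  -- The clique vertices alternating with x form an arc of the cyclic order.
  ¬alternating-separated : ∀ {x u v p q} → Separate u v p q → x ∼ p → x ∼ q → ¬ x ∼ u → ¬ x ∼ v → ⊥
  ¬alternating-separated (inj₁ (p-in , q-out)) x∼p x∼q = ¬alternating-between-outside p-in q-out x∼p x∼q
  ¬alternating-separated (inj₂ (q-in , p-out)) x∼p x∼q = ¬alternating-between-outside q-in p-out x∼q x∼p

module M-III (n : ℕ) (w : List (VtxIII (4 + n))) (w-covers : ∀ v → v ∈ w)
  (adj⇔alt : ∀ x y → x ≢ y → AdjIII (4 + n) x y ⇔ Alternate _≟V_ w x y) where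

  k m : ℕ
  k = 4 + n
  m = 3 + n

  open Alternation (_≟V_ {k})

  adjacent⇔alternating : ∀ {x y} → x ≢ y → AdjIII k x y ⇔ Alternating x y w
  adjacent⇔alternating {x} {y} x≢y = alternate⇔alternating w x≢y ⇔-∘ adj⇔alt x y x≢y

  c-injective : ∀ {i j : Fin (suc k)} → c i ≡ c j → i ≡ j
  c-injective refl = refl

  open Clique (_≟V_ {k}) w c c-injective (w-covers ∘ c)
    (λ i≢j → Equivalence.to (adjacent⇔alternating (i≢j ∘ c-injective)) i≢j)

  -- pos t is c_{t+1}; arguments beyond k are clamped and never used.
  pos : ℕ → Fin (suc k)
  pos t = fromℕ< (s≤s (m⊓n≤n t k))

  toℕ-pos : ∀ {t} → t ≤ k → toℕ (pos t) ≡ t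
  toℕ-pos t≤k = trans (toℕ-fromℕ< _) (m≤n⇒m⊓n≡m t≤k)

  pos-injective : ∀ {s t} → s ≤ m → t ≤ m → pos s ≡ pos t → s ≡ t
  pos-injective s≤m t≤m eq =
    trans (sym (toℕ-pos (≤-trans s≤m (n≤1+n m)))) (trans (cong toℕ eq) (toℕ-pos (≤-trans t≤m (n≤1+n m))))

  pos≢posₖ : ∀ {t} → t ≤ m → pos t ≢ pos k
  pos≢posₖ {t} t≤m eq =
    <⇒≢ (s≤s t≤m) (trans (sym (toℕ-pos (≤-trans t≤m (n≤1+n m)))) (trans (cong toℕ eq) (toℕ-pos ≤-refl)))

  a-alternating⇔ : ∀ {t} (t<m : t < m) {l} → a (fromℕ< t<m) ∼ l ⇔ (toℕ l ≡ t ⊎ toℕ l ≡ suc t)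
  a-alternating⇔ t<m = mk⇔
    (Data.Sum.map (λ eq → trans (suc-injective eq) (toℕ-fromℕ< t<m))
                  (λ eq → trans (suc-injective eq) (cong suc (toℕ-fromℕ< t<m)))
       ∘ Equivalence.from (adjacent⇔alternating λ ()))
    (Equivalence.to (adjacent⇔alternating λ ())
       ∘ Data.Sum.map (λ eq → cong suc (trans eq (sym (toℕ-fromℕ< t<m))))
                      (λ eq → cong suc (trans eq (cong suc (sym (toℕ-fromℕ< t<m))))))

  path-step : ∀ t → t < m → pos t ↝ pos (suc t) ⊎ pos (suc t) ↝ pos t
  path-step t t<m =
    alternating-adjacent (Equivalence.from aₜ∼ (inj₁ (toℕ-pos t≤k))) (Equivalence.from aₜ∼ (inj₂ (toℕ-pos t<k)))
      (<⇒≢ (n<1+n t) ∘ pos-injective (<⇒≤ t<m) t<m) others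
    where
      t<k : t < k
      t<k = ≤-trans t<m (n≤1+n m)
      t≤k : t ≤ k
      t≤k = <⇒≤ t<k
      aₜ∼ : ∀ {l} → a (fromℕ< t<m) ∼ l ⇔ (toℕ l ≡ t ⊎ toℕ l ≡ suc t)
      aₜ∼ = a-alternating⇔ t<m
      others : ∀ {l} → l ≢ pos t → l ≢ pos (suc t) → ¬ a (fromℕ< t<m) ∼ l
      others l≢posₜ l≢posₜ₊₁ = Data.Sum.[ l≢posₜ ∘ toℕ-injective ∘ (λ eq → trans eq (sym (toℕ-pos t≤k)))
                                        , l≢posₜ₊₁ ∘ toℕ-injective ∘ (λ eq → trans eq (sym (toℕ-pos t<k))) ]
                               ∘ Equivalence.to aₜ∼

  b≁pos₀ : ¬ bv ∼ pos 0
  b≁pos₀ = (λ { (inj₁ (s≤s () , _)) ; (inj₂ ()) }) ∘ Equivalence.from (adjacent⇔alternating λ ())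

  b≁posₘ : ¬ bv ∼ pos m
  b≁posₘ = ¬adjacent ∘ Equivalence.from (adjacent⇔alternating λ ())
    where
      ¬adjacent : ¬ bAdj k (pos m)
      ¬adjacent (inj₁ (_ , m+1≤m)) = 1+n≰n (subst (λ i → suc i ≤ m) (toℕ-pos (n≤1+n m)) m+1≤m)
      ¬adjacent (inj₂ eq)          = <⇒≢ (n<1+n m) (trans (sym (toℕ-pos (n≤1+n m))) (suc-injective eq))

  b∼pos₁ : bv ∼ pos 1
  b∼pos₁ = Equivalence.to (adjacent⇔alternating λ ()) (inj₁ (s≤s (s≤s z≤n) , s≤s (s≤s z≤n)))

  b∼posₖ : bv ∼ pos k
  b∼posₖ = Equivalence.to (adjacent⇔alternating λ ()) (inj₂ (cong suc (toℕ-pos ≤-refl)))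

  impossible : ⊥
  impossible = ¬alternating-separated
    (path-separates pos-injective pos≢posₖ path-step (s≤s (s≤s z≤n)))
    b∼pos₁ b∼posₖ b≁pos₀ b≁posₘ

-- The argument does not use that k is even.
lemma11 : (k : ℕ) → 2 ∣ k → 4 ≤ k →
    ¬ WordRepresentable (VtxIII k) _≟V_ (AdjIII k)
lemma11 k _ 4≤k (w , w-covers , adj⇔alt) with m≤n⇒∃[o]m+o≡n 4≤k
... | n , refl = M-III.impossible n w w-covers adj⇔alt
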